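{- Let $M=(E,\rho)$ be a simple binary matroid that contains no isthmuses. Then the lattice of cyclic flats $\mathcal{Z}(M)$ is atomic, i.e. every element of $\mathcal{Z}(M)$ is a join of atoms.
   Context: A matroid is binary if it is representable over $\mathbb{F}_2$; simple means it has no loops and no parallel elements; an isthmus (coloop) is an element $e$ with $\rho(E-e)<\rho(E)$. A cyclic flat is a set $X$ with $\mathrm{cl}(X)=X$ and $\mathrm{cyc}(X)=X$, where $\mathrm{cl}(X)=\{e:\rho(X\cup e)=\rho(X)\}$ and $\mathrm{cyc}(X)=\{e\in X:\rho(X-e)=\rho(X)\}$. $\mathcal{Z}(M)$ is the lattice of cyclic flats under inclusion, with join $X\vee Y=\mathrm{cl}(X\cup Y)$ and meet $X\wedge Y=\mathrm{cyc}(X\cap Y)$; an atom is an element covering the bottom element. -}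

module Defs where

open import Data.Nat using (ℕ; zero; suc; _≤_; _<_; _+_; _≟_)
open import Data.Bool using (Bool; true; false; _xor_; _∧_; if_then_else_)
open import Data.Fin using (Fin; zero; suc)
open import Data.Fin.Subset
  using (Subset; _⊆_; _⊂_; _∪_; _∩_; _-_; ∣_∣; ⁅_⁆; ⊤; ⊥; Nonempty)
open import Data.Vec using (Vec; []; _∷_; tabulate; lookup; replicate; zipWith)
import Data.Sum
open import Data.Product using (Σ; ∃; _×_; _,_)
open import Data.List using (List; foldr)
open import Relation.Binary.PropositionalEquality using (_≡_; _≢_)
open import Relation.Nullary using (¬_)
open import Relation.Nullary.Decidable using (⌊_⌋)

record Matroid (n : ℕ) : Set where
  field
    ρ          : Subset n → ℕ
    bounded    : ∀ X → ρ X ≤ ∣ X ∣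
    monotone   : ∀ {X Y} → X ⊆ Y → ρ X ≤ ρ Y
    submodular : ∀ X Y → ρ (X ∪ Y) + ρ (X ∩ Y) ≤ ρ X + ρ Y

module _ {n : ℕ} (M : Matroid n) where
  open Matroid M

  cl : Subset n → Subset n
  cl X = tabulate (λ e → ⌊ ρ (X ∪ ⁅ e ⁆) ≟ ρ X ⌋)

  cyc : Subset n → Subset n
  cyc X = tabulate (λ e → lookup X e ∧ ⌊ ρ (X - e) ≟ ρ X ⌋)

  IsCyclicFlat : Subset n → Set
  IsCyclicFlat X = (cl X ≡ X) × (cyc X ≡ X)

  _∨_ : Subset n → Subset n → Subset n
  X ∨ Y = cl (X ∪ Y)

  -- the join of a finite family of cyclic flats; the empty join is cl(∅),
  -- the bottom element of Z(M)
  ⋁ : List (Subset n) → Subset n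
  ⋁ As = foldr _∨_ (cl ⊥) As

  IsBottom : Subset n → Set
  IsBottom B = IsCyclicFlat B × (∀ W → IsCyclicFlat W → B ⊆ W)

  IsAtom : Subset n → Set
  IsAtom Z = IsCyclicFlat Z × Σ (Subset n) λ B → IsBottom B × B ⊂ Z ×
    (∀ W → IsCyclicFlat W → B ⊆ W → W ⊆ Z → (W ≡ B) Data.Sum.⊎ (W ≡ Z))

  IsSimple : Set
  IsSimple = (∀ e → ρ ⁅ e ⁆ ≡ 1) × (∀ e f → e ≢ f → ρ (⁅ e ⁆ ∪ ⁅ f ⁆) ≡ 2)

  IsIsthmus : Fin n → Set
  IsIsthmus e = ρ (⊤ - e) < ρ ⊤

-- ℱ₂-linear algebra: vectors in ℱ₂^m as Vec Bool m, addition = xor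
xorSum : ∀ {n m} → (Fin n → Vec Bool m) → Subset n → Vec Bool m
xorSum {zero}  {m} v []      = replicate m false
xorSum {suc n} {m} v (b ∷ J) =
  let rest = xorSum (λ i → v (suc i)) J in
  if b then zipWith _xor_ (v zero) rest else rest

-- I is linearly independent over ℱ₂ (as a set of columns of v): no nonempty
-- subset of I sums to zero
IndepF2 : ∀ {n m} → (Fin n → Vec Bool m) → Subset n → Set
IndepF2 {n} {m} v I = ∀ (J : Subset n) → J ⊆ I → Nonempty J → xorSum v J ≢ replicate m false

IsRankF2 : ∀ {n m} → (Fin n → Vec Bool m) → Subset n → ℕ → Set
IsRankF2 {n} v X r =
  (Σ (Subset n) λ I → I ⊆ X × IndepF2 v I × ∣ I ∣ ≡ r) ×
  (∀ (I : Subset n) → I ⊆ X → IndepF2 v I → ∣ I ∣ ≤ r)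

IsBinary : ∀ {n} → Matroid n → Set
IsBinary {n} M = Σ ℕ λ m → Σ (Fin n → Vec Bool m) λ v →
  ∀ X → IsRankF2 v X (Matroid.ρ M X)

-- Over 𝔽₂ the sets whose vectors sum to zero are closed under symmetric difference.
-- Every y in a cyclic flat X lies in such a set inside X; let C be a smallest one
-- containing y. Minimality makes C a circuit, hence cyclic. C is also closed: an
-- f ∈ cl C − C gives a zero-sum D ⊆ C ∪ {f} through f, one of D and C Δ D contains y
-- and so is at least as large as C, and counting then leaves the other with at most two
-- elements, impossible in a simple binary matroid. Since ∅ is the bottom and every
-- nonempty cyclic flat inside C contains a circuit, C is an atom; X is the join of
-- these atoms.

module Submission where

open import Defs
open import Data.Nat using (ℕ; zero; suc; _≤_; _<_; _+_; _≤?_; z≤n; s≤s; s≤s⁻¹)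
open import Data.Nat.Properties
open import Data.Bool using (Bool; true; false; _xor_; T)
import Data.Bool
open import Data.Bool.Properties using (xor-assoc; xor-comm; xor-same; T-≡; T-∧)
open import Data.Fin using (Fin; zero; suc)
import Data.Fin as Fin
open import Data.Fin.Subset
open import Data.Fin.Subset.Properties
open import Data.Vec using (Vec; []; _∷_; lookup; replicate; zipWith; tabulate; here; there)
open import Data.Vec.Properties
  using ([]=⇒lookup; lookup⇒[]=; lookup∘tabulate; zipWith-assoc; zipWith-comm; zipWith-identityˡ; ≡-dec)
open import Data.List using (List; []; _∷_; allFin)
open import Data.List.Relation.Unary.All using (All; []; _∷_)
open import Data.List.Relation.Unary.Any using (here; there)
import Data.List.Membership.Propositional as List
open import Data.List.Membership.Propositional.Properties using (∈-allFin)
open import Data.Product using (Σ; ∃; _×_; _,_; proj₁; proj₂)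
import Data.Product as Product
open import Data.Sum using (_⊎_; inj₁; inj₂)
import Data.Sum as Sum
open import Data.Empty using (⊥-elim)
open import Function using (_∘_; id)
open import Function.Bundles using (Equivalence)
open import Level using (0ℓ)
open import Algebra.Bundles using (CommutativeSemigroup)
open import Algebra.Structures using (IsCommutativeSemigroup)
import Algebra.Properties.CommutativeSemigroup
open import Relation.Binary.PropositionalEquality
open import Relation.Nullary using (¬_; yes; no; contradiction)
open import Relation.Nullary.Decidable using (toWitness; fromWitness; _×-dec_)
open import Relation.Unary using (Pred; Decidable)

infixl 6 _⊕_ _Δ_

_⊕_ : ∀ {k} → Vec Bool k → Vec Bool k → Vec Bool k
_⊕_ = zipWith _xor_

𝟎 : ∀ {k} → Vec Bool k
𝟎 = replicate _ false

_Δ_ : ∀ {n} → Subset n → Subset n → Subset n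
_Δ_ = _⊕_

⊕-assoc : ∀ {k} (a b c : Vec Bool k) → (a ⊕ b) ⊕ c ≡ a ⊕ (b ⊕ c)
⊕-assoc = zipWith-assoc xor-assoc

⊕-isCommutativeSemigroup : ∀ {k} → IsCommutativeSemigroup _≡_ (_⊕_ {k})
⊕-isCommutativeSemigroup = record
  { isSemigroup = record
    { isMagma = record { isEquivalence = isEquivalence ; ∙-cong = cong₂ _⊕_ }
    ; assoc   = ⊕-assoc
    }
  ; comm = zipWith-comm xor-comm
  }

⊕-commutativeSemigroup : ℕ → CommutativeSemigroup 0ℓ 0ℓ
⊕-commutativeSemigroup k = record { isCommutativeSemigroup = ⊕-isCommutativeSemigroup {k} }

open module ⊕-Properties {k} = Algebra.Properties.CommutativeSemigroup (⊕-commutativeSemigroup k)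
  using (interchange; x∙yz≈y∙xz)

⊕-identityˡ : ∀ {k} (a : Vec Bool k) → 𝟎 ⊕ a ≡ a
⊕-identityˡ = zipWith-identityˡ (λ _ → refl)

⊕-self : ∀ {k} (a : Vec Bool k) → a ⊕ a ≡ 𝟎
⊕-self []      = refl
⊕-self (x ∷ a) = cong₂ _∷_ (xor-same x) (⊕-self a)

xorSum-Δ : ∀ {n m} (v : Fin n → Vec Bool m) (p q : Subset n) →
           xorSum v (p Δ q) ≡ xorSum v p ⊕ xorSum v q
xorSum-Δ v [] [] = sym (⊕-identityˡ 𝟎)
xorSum-Δ v (true ∷ p) (true ∷ q) = begin
  xorSum (v ∘ suc) (p Δ q)          ≡⟨ xorSum-Δ (v ∘ suc) p q ⟩
  P ⊕ Q                             ≡⟨ ⊕-identityˡ (P ⊕ Q) ⟨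
  𝟎 ⊕ (P ⊕ Q)                       ≡⟨ cong (_⊕ (P ⊕ Q)) (⊕-self (v zero)) ⟨
  (v zero ⊕ v zero) ⊕ (P ⊕ Q)       ≡⟨ interchange (v zero) P (v zero) Q ⟨
  (v zero ⊕ P) ⊕ (v zero ⊕ Q)       ∎
  where open ≡-Reasoning
        P = xorSum (v ∘ suc) p
        Q = xorSum (v ∘ suc) q
xorSum-Δ v (true ∷ p) (false ∷ q) =
  trans (cong (v zero ⊕_) (xorSum-Δ (v ∘ suc) p q)) (sym (⊕-assoc (v zero) _ _))
xorSum-Δ v (false ∷ p) (true ∷ q) =
  trans (cong (v zero ⊕_) (xorSum-Δ (v ∘ suc) p q)) (x∙yz≈y∙xz (v zero) _ _)
xorSum-Δ v (false ∷ p) (false ∷ q) = xorSum-Δ (v ∘ suc) p q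

x∈p⇒T : ∀ {n} {x : Fin n} {p} → x ∈ p → T (lookup p x)
x∈p⇒T = Equivalence.from T-≡ ∘ []=⇒lookup

T⇒x∈p : ∀ {n} {x : Fin n} {p} → T (lookup p x) → x ∈ p
T⇒x∈p {x = x} {p} = lookup⇒[]= x p ∘ Equivalence.to T-≡

∈-tabulate⁻ : ∀ {n} {f : Fin n → Bool} {x} → x ∈ tabulate f → T (f x)
∈-tabulate⁻ {f = f} {x} = subst T (lookup∘tabulate f x) ∘ x∈p⇒T

∈-tabulate⁺ : ∀ {n} {f : Fin n → Bool} {x} → T (f x) → x ∈ tabulate f
∈-tabulate⁺ {f = f} {x} = T⇒x∈p ∘ subst T (sym (lookup∘tabulate f x))

∪-least : ∀ {n} {p q r : Subset n} → p ⊆ r → q ⊆ r → p ∪ q ⊆ r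
∪-least {p = p} {q} p⊆r q⊆r = Sum.[ p⊆r , q⊆r ] ∘ x∈p∪q⁻ p q

⁅x⁆⊆p : ∀ {n} {x : Fin n} {p} → x ∈ p → ⁅ x ⁆ ⊆ p
⁅x⁆⊆p {x = x} x∈p y∈⁅x⁆ = subst (_∈ _) (sym (x∈⁅y⁆⇒x≡y x y∈⁅x⁆)) x∈p

x∉p-x : ∀ {n} {x : Fin n} (p : Subset n) → x ∉ p - x
x∉p-x {x = zero}  (_ ∷ p) ()
x∉p-x {x = suc x} (_ ∷ p) (there x∈p-x) = x∉p-x p x∈p-x

p-x⊆q⇒p⊆q∪⁅x⁆ : ∀ {n} {x : Fin n} {p q} → p - x ⊆ q → p ⊆ q ∪ ⁅ x ⁆
p-x⊆q⇒p⊆q∪⁅x⁆ {x = x} {p} {q} p-x⊆q {y} y∈p with y Fin.≟ x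
... | yes refl = q⊆p∪q q ⁅ y ⁆ (x∈⁅x⁆ y)
... | no  y≢x  = p⊆p∪q ⁅ x ⁆ (p-x⊆q (x∈p∧x≢y⇒x∈p-y y∈p y≢x))

∣p∪q∣≤∣p∣+∣q∣ : ∀ {n} (p q : Subset n) → ∣ p ∪ q ∣ ≤ ∣ p ∣ + ∣ q ∣
∣p∪q∣≤∣p∣+∣q∣ []          []          = z≤n
∣p∪q∣≤∣p∣+∣q∣ (true  ∷ p) (c ∷ q)     = s≤s (≤-trans (∣p∪q∣≤∣p∣+∣q∣ p q) (+-monoʳ-≤ ∣ p ∣ (∣p∣≤∣x∷p∣ c q)))
∣p∪q∣≤∣p∣+∣q∣ (false ∷ p) (true  ∷ q) = subst (suc ∣ p ∪ q ∣ ≤_) (sym (+-suc ∣ p ∣ ∣ q ∣)) (s≤s (∣p∪q∣≤∣p∣+∣q∣ p q))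
∣p∪q∣≤∣p∣+∣q∣ (false ∷ p) (false ∷ q) = ∣p∪q∣≤∣p∣+∣q∣ p q

p-x⊆q⇒∣p∣≤1+∣q∣ : ∀ {n} {x : Fin n} {p q} → p - x ⊆ q → ∣ p ∣ ≤ suc ∣ q ∣
p-x⊆q⇒∣p∣≤1+∣q∣ {x = x} {p} {q} p-x⊆q = begin
  ∣ p ∣               ≤⟨ p⊆q⇒∣p∣≤∣q∣ (p-x⊆q⇒p⊆q∪⁅x⁆ p-x⊆q) ⟩
  ∣ q ∪ ⁅ x ⁆ ∣       ≤⟨ ∣p∪q∣≤∣p∣+∣q∣ q ⁅ x ⁆ ⟩
  ∣ q ∣ + ∣ ⁅ x ⁆ ∣   ≡⟨ cong (∣ q ∣ +_) (∣⁅x⁆∣≡1 x) ⟩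
  ∣ q ∣ + 1           ≡⟨ +-comm ∣ q ∣ 1 ⟩
  suc ∣ q ∣           ∎
  where open ≤-Reasoning

p⊆q⇒∣q∣≤∣p∣⇒p≡q : ∀ {n} {p q : Subset n} → p ⊆ q → ∣ q ∣ ≤ ∣ p ∣ → p ≡ q
p⊆q⇒∣q∣≤∣p∣⇒p≡q {p = []}        {[]}        _   _ = refl
p⊆q⇒∣q∣≤∣p∣⇒p≡q {p = true  ∷ p} {true  ∷ q} p⊆q c =
  cong (true ∷_) (p⊆q⇒∣q∣≤∣p∣⇒p≡q (drop-∷-⊆ p⊆q) (s≤s⁻¹ c))
p⊆q⇒∣q∣≤∣p∣⇒p≡q {p = true  ∷ p} {false ∷ q} p⊆q c with () ← p⊆q here
p⊆q⇒∣q∣≤∣p∣⇒p≡q {p = false ∷ p} {true  ∷ q} p⊆q c =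
  contradiction c (<⇒≱ (s≤s (p⊆q⇒∣p∣≤∣q∣ (drop-∷-⊆ p⊆q))))
p⊆q⇒∣q∣≤∣p∣⇒p≡q {p = false ∷ p} {false ∷ q} p⊆q c =
  cong (false ∷_) (p⊆q⇒∣q∣≤∣p∣⇒p≡q (drop-∷-⊆ p⊆q) c)

∈Δ⁻ : ∀ {n} {x : Fin n} (p q : Subset n) → x ∈ p Δ q → (x ∈ p × x ∉ q) ⊎ (x ∉ p × x ∈ q)
∈Δ⁻ (true  ∷ p) (false ∷ q) here = inj₁ (here , λ ())
∈Δ⁻ (false ∷ p) (true  ∷ q) here = inj₂ ((λ ()) , here)
∈Δ⁻ (_ ∷ p) (_ ∷ q) (there x∈pΔq) =
  Sum.map (Product.map there (_∘ drop-there)) (Product.map (_∘ drop-there) there) (∈Δ⁻ p q x∈pΔq)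

∈Δ⁺ˡ : ∀ {n} {x : Fin n} (p q : Subset n) → x ∈ p → x ∉ q → x ∈ p Δ q
∈Δ⁺ˡ (true ∷ p) (true  ∷ q) here x∉q = contradiction here x∉q
∈Δ⁺ˡ (true ∷ p) (false ∷ q) here x∉q = here
∈Δ⁺ˡ (_ ∷ p) (_ ∷ q) (there x∈p) x∉q = there (∈Δ⁺ˡ p q x∈p (x∉q ∘ there))

∈Δ⁺ʳ : ∀ {n} {x : Fin n} (p q : Subset n) → x ∉ p → x ∈ q → x ∈ p Δ q
∈Δ⁺ʳ (true  ∷ p) (true ∷ q) x∉p here = contradiction here x∉p
∈Δ⁺ʳ (false ∷ p) (true ∷ q) x∉p here = here
∈Δ⁺ʳ (_ ∷ p) (_ ∷ q) x∉p (there x∈q) = there (∈Δ⁺ʳ p q (x∉p ∘ there) x∈q)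

Δ-least : ∀ {n} {p q r : Subset n} → p ⊆ r → q ⊆ r → p Δ q ⊆ r
Δ-least {p = p} {q} p⊆r q⊆r = Sum.[ p⊆r ∘ proj₁ , q⊆r ∘ proj₂ ] ∘ ∈Δ⁻ p q

Δ⊂ : ∀ {n} {p q : Subset n} → q ⊆ p → Nonempty q → p Δ q ⊂ p
Δ⊂ {p = p} {q} q⊆p (x , x∈q) = Δ-least ⊆-refl q⊆p , x , q⊆p x∈q ,
  Sum.[ (λ (_ , x∉q) → x∉q x∈q) , (λ (x∉p , _) → x∉p (q⊆p x∈q)) ] ∘ ∈Δ⁻ p q

∣p∣+∣q∣≡∣pΔq∣+2∣p∩q∣ : ∀ {n} (p q : Subset n) →
                      ∣ p ∣ + ∣ q ∣ ≡ ∣ p Δ q ∣ + (∣ p ∩ q ∣ + ∣ p ∩ q ∣)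
∣p∣+∣q∣≡∣pΔq∣+2∣p∩q∣ [] [] = refl
∣p∣+∣q∣≡∣pΔq∣+2∣p∩q∣ (true ∷ p) (true ∷ q) = begin
  suc (∣ p ∣ + suc ∣ q ∣)        ≡⟨ cong suc (+-suc ∣ p ∣ ∣ q ∣) ⟩
  2 + (∣ p ∣ + ∣ q ∣)            ≡⟨ cong (2 +_) (∣p∣+∣q∣≡∣pΔq∣+2∣p∩q∣ p q) ⟩
  2 + (k + (i + i))              ≡⟨ cong suc (+-suc k (i + i)) ⟨
  suc (k + suc (i + i))          ≡⟨ +-suc k (suc (i + i)) ⟨
  k + (2 + (i + i))              ≡⟨ cong (λ j → k + suc j) (+-suc i i) ⟨
  k + (suc i + suc i)            ∎
  where open ≡-Reasoning
        k = ∣ p Δ q ∣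
        i = ∣ p ∩ q ∣
∣p∣+∣q∣≡∣pΔq∣+2∣p∩q∣ (true  ∷ p) (false ∷ q) = cong suc (∣p∣+∣q∣≡∣pΔq∣+2∣p∩q∣ p q)
∣p∣+∣q∣≡∣pΔq∣+2∣p∩q∣ (false ∷ p) (true  ∷ q) =
  trans (+-suc ∣ p ∣ ∣ q ∣) (cong suc (∣p∣+∣q∣≡∣pΔq∣+2∣p∩q∣ p q))
∣p∣+∣q∣≡∣pΔq∣+2∣p∩q∣ (false ∷ p) (false ∷ q) = ∣p∣+∣q∣≡∣pΔq∣+2∣p∩q∣ p q

x∈p-y⇒x≢y : ∀ {n} {x y : Fin n} (p : Subset n) → x ∈ p - y → x ≢ y
x∈p-y⇒x≢y p x∈p-x refl = x∉p-x p x∈p-x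

Empty[p-x]⇒p⊆⁅x⁆ : ∀ {n} {x : Fin n} {p} → Empty (p - x) → p ⊆ ⁅ x ⁆
Empty[p-x]⇒p⊆⁅x⁆ {x = x} empty =
  ⊆-trans (p-x⊆q⇒p⊆q∪⁅x⁆ (λ y∈p-x → contradiction (_ , y∈p-x) empty)) (⊆-reflexive (∪-identityˡ ⁅ x ⁆))

Smallest : ∀ {n} → Pred (Subset n) 0ℓ → Subset n → Set
Smallest P C = P C × (∀ K → P K → ∣ C ∣ ≤ ∣ K ∣)

smallest : ∀ {n} {P : Pred (Subset n) 0ℓ} → Decidable P → ∃ P → ∃ (Smallest P)
smallest {P = P} P? (J , PJ) = descend ∣ J ∣ J ≤-refl PJ
  where
  descend : ∀ k J → ∣ J ∣ ≤ k → P J → ∃ (Smallest P)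
  descend zero    J ∣J∣≤0 PJ = J , PJ , λ _ _ → ≤-trans ∣J∣≤0 z≤n
  descend (suc k) J ∣J∣≤k PJ with anySubset? (λ K → P? K ×-dec (suc ∣ K ∣ ≤? ∣ J ∣))
  ... | yes (K , PK , K<J) = descend k K (s≤s⁻¹ (≤-trans K<J ∣J∣≤k)) PK
  ... | no  ∄smaller       = J , PJ , λ K PK → ≮⇒≥ (λ K<J → ∄smaller (K , PK , K<J))

-- Read c = ∣ C ∣, d = ∣ D ∣, k = ∣ C Δ D ∣, i = ∣ C ∩ D ∣ for D ⊆ C ∪ ⁅ f ⁆ with f ∈ D, f ∉ C.
exchange-bound : ∀ {c d k i} → c + d ≡ k + (i + i) → d ≤ suc i → c ≤ d ⊎ c ≤ k → d ≤ 2 ⊎ k ≤ 2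
exchange-bound {c} {d} {k} {i} eq d≤1+i (inj₁ c≤d) = inj₂ (+-cancelʳ-≤ (i + i) k 2 (begin
  k + (i + i)       ≡⟨ eq ⟨
  c + d             ≤⟨ +-monoˡ-≤ d c≤d ⟩
  d + d             ≤⟨ +-mono-≤ d≤1+i d≤1+i ⟩
  suc i + suc i     ≡⟨ cong suc (+-suc i i) ⟩
  2 + (i + i)       ∎))
  where open ≤-Reasoning
exchange-bound {c} {d} {k} {i} eq d≤1+i (inj₂ c≤k) = inj₁ (≤-trans d≤1+i (s≤s i≤1))
  where
  i+i≤d : i + i ≤ d
  i+i≤d = +-cancelˡ-≤ c (i + i) d (≤-trans (+-monoˡ-≤ (i + i) c≤k) (≤-reflexive (sym eq)))
  i≤1 : i ≤ 1
  i≤1 = +-cancelʳ-≤ i i 1 (≤-trans i+i≤d d≤1+i)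

module _ {n : ℕ} (M : Matroid n) where
  open Matroid M

  ∈-cl⁻ : ∀ {X x} → x ∈ cl M X → ρ (X ∪ ⁅ x ⁆) ≡ ρ X
  ∈-cl⁻ = toWitness ∘ ∈-tabulate⁻

  ∈-cl⁺ : ∀ {X x} → ρ (X ∪ ⁅ x ⁆) ≡ ρ X → x ∈ cl M X
  ∈-cl⁺ = ∈-tabulate⁺ ∘ fromWitness

  ∈-cyc⁻ : ∀ {X x} → x ∈ cyc M X → x ∈ X × ρ (X - x) ≡ ρ X
  ∈-cyc⁻ = Product.map T⇒x∈p toWitness ∘ Equivalence.to T-∧ ∘ ∈-tabulate⁻

  ∈-cyc⁺ : ∀ {X x} → x ∈ X → ρ (X - x) ≡ ρ X → x ∈ cyc M X
  ∈-cyc⁺ x∈X eq = ∈-tabulate⁺ (Equivalence.from T-∧ (x∈p⇒T x∈X , fromWitness eq))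

  cyc-⊆ : ∀ X → cyc M X ⊆ X
  cyc-⊆ X = proj₁ ∘ ∈-cyc⁻

  ⊆-cl : ∀ X → X ⊆ cl M X
  ⊆-cl X {x} x∈X = ∈-cl⁺ (≤-antisym (monotone (∪-least ⊆-refl (⁅x⁆⊆p x∈X))) (monotone (p⊆p∪q ⁅ x ⁆)))

  cl-mono : ∀ {X Y} → Y ⊆ X → cl M Y ⊆ cl M X
  cl-mono {X} {Y} Y⊆X {x} x∈clY = ∈-cl⁺ (≤-antisym ρX∪x≤ρX (monotone (p⊆p∪q ⁅ x ⁆)))
    where
    ρX∪x≤ρX : ρ (X ∪ ⁅ x ⁆) ≤ ρ X
    ρX∪x≤ρX = +-cancelʳ-≤ (ρ Y) _ _ (begin
      ρ (X ∪ ⁅ x ⁆) + ρ Y                       ≤⟨ +-mono-≤ (monotone X∪x⊆) (monotone Y⊆) ⟩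
      ρ (X ∪ (Y ∪ ⁅ x ⁆)) + ρ (X ∩ (Y ∪ ⁅ x ⁆))  ≤⟨ submodular X (Y ∪ ⁅ x ⁆) ⟩
      ρ X + ρ (Y ∪ ⁅ x ⁆)                        ≡⟨ cong (ρ X +_) (∈-cl⁻ x∈clY) ⟩
      ρ X + ρ Y                                  ∎)
      where
      open ≤-Reasoning
      X∪x⊆ : X ∪ ⁅ x ⁆ ⊆ X ∪ (Y ∪ ⁅ x ⁆)
      X∪x⊆ = ∪-least (p⊆p∪q _) (⊆-trans (q⊆p∪q Y ⁅ x ⁆) (q⊆p∪q X _))
      Y⊆ : Y ⊆ X ∩ (Y ∪ ⁅ x ⁆)
      Y⊆ y∈Y = x∈p∩q⁺ (Y⊆X y∈Y , p⊆p∪q ⁅ x ⁆ y∈Y)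

  cl-⊆-flat : ∀ {X Y} → cl M X ≡ X → Y ⊆ X → cl M Y ⊆ X
  cl-⊆-flat flat Y⊆X = ⊆-trans (cl-mono Y⊆X) (⊆-reflexive flat)

  ⋁-least : ∀ {X} → cl M X ≡ X → ∀ {As} → All (_⊆ X) As → ⋁ M As ⊆ X
  ⋁-least flat []              = cl-⊆-flat flat ⊥⊆
  ⋁-least flat (A⊆X ∷ As⊆X)    = cl-⊆-flat flat (∪-least A⊆X (⋁-least flat As⊆X))

  ⊆-⋁-head : ∀ A As → A ⊆ ⋁ M (A ∷ As)
  ⊆-⋁-head A As = ⊆-trans (p⊆p∪q (⋁ M As)) (⊆-cl (A ∪ ⋁ M As))

  ⊆-⋁-tail : ∀ A As → ⋁ M As ⊆ ⋁ M (A ∷ As)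
  ⊆-⋁-tail A As = ⊆-trans (q⊆p∪q A (⋁ M As)) (⊆-cl (A ∪ ⋁ M As))

  covering-join : ∀ {X} (P : Pred (Subset n) 0ℓ) → (∀ {y} → y ∈ X → ∃ λ C → P C × C ⊆ X × y ∈ C) →
                  ∀ L → ∃ λ As → All P As × All (_⊆ X) As × (∀ {y} → y ∈ X → y List.∈ L → y ∈ ⋁ M As)
  covering-join P cover [] = [] , [] , [] , λ _ ()
  covering-join {X} P cover (y ∷ L) with covering-join P cover L | y ∈? X
  ... | As , PAs , As⊆X , covered | no y∉X =
    As , PAs , As⊆X , λ { y∈X (here refl) → contradiction y∈X y∉X ; y∈X (there y∈L) → covered y∈X y∈L }
  ... | As , PAs , As⊆X , covered | yes y∈X =
    let C , PC , C⊆X , y∈C = cover y∈X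
    in C ∷ As , PC ∷ PAs , C⊆X ∷ As⊆X ,
       λ { _ (here refl) → ⊆-⋁-head C As y∈C ; y∈X (there y∈L) → ⊆-⋁-tail C As (covered y∈X y∈L) }

  flat-join-of-cover : ∀ {X} (P : Pred (Subset n) 0ℓ) → cl M X ≡ X →
                       (∀ {y} → y ∈ X → ∃ λ C → P C × C ⊆ X × y ∈ C) →
                       ∃ λ As → All P As × X ≡ ⋁ M As
  flat-join-of-cover P flat cover =
    let As , PAs , As⊆X , covered = covering-join P cover (allFin n)
    in As , PAs , ⊆-antisym (λ y∈X → covered y∈X (∈-allFin _)) (⋁-least flat As⊆X)

module Binary {n : ℕ} (M : Matroid n) {m : ℕ} (v : Fin n → Vec Bool m)
              (rep : ∀ X → IsRankF2 v X (Matroid.ρ M X)) where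
  open Matroid M

  SumsToZero : Pred (Subset n) 0ℓ
  SumsToZero J = xorSum v J ≡ 𝟎

  sumsToZero? : Decidable SumsToZero
  sumsToZero? J = ≡-dec Data.Bool._≟_ (xorSum v J) 𝟎

  sumsToZero-Δ : ∀ {P Q} → SumsToZero P → SumsToZero Q → SumsToZero (P Δ Q)
  sumsToZero-Δ {P} {Q} P≡𝟎 Q≡𝟎 = trans (xorSum-Δ v P Q) (trans (cong₂ _⊕_ P≡𝟎 Q≡𝟎) (⊕-self 𝟎))

  indep⇒∣I∣≤ρ : ∀ {I X} → I ⊆ X → IndepF2 v I → ∣ I ∣ ≤ ρ X
  indep⇒∣I∣≤ρ {I} {X} = proj₂ (rep X) I

  ∣S∣≤ρ⇒indep : ∀ {S} → ∣ S ∣ ≤ ρ S → IndepF2 v S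
  ∣S∣≤ρ⇒indep {S} ∣S∣≤ρS with proj₁ (rep S)
  ... | I , I⊆S , indI , ∣I∣≡ρS =
    subst (IndepF2 v) (p⊆q⇒∣q∣≤∣p∣⇒p≡q I⊆S (subst (∣ S ∣ ≤_) (sym ∣I∣≡ρS) ∣S∣≤ρS)) indI

  sumsToZero⇒ρ<∣∣ : ∀ {S} → Nonempty S → SumsToZero S → ρ S < ∣ S ∣
  sumsToZero⇒ρ<∣∣ {S} S≢∅ S≡𝟎 = ≰⇒> (λ ∣S∣≤ρS → ∣S∣≤ρ⇒indep ∣S∣≤ρS S ⊆-refl S≢∅ S≡𝟎)

  dependent⇒sumsToZero : ∀ {S} → ¬ IndepF2 v S → ∃ λ J → J ⊆ S × Nonempty J × SumsToZero J
  dependent⇒sumsToZero {S} dep with anySubset? (λ J → J ⊆? S ×-dec nonempty? J ×-dec sumsToZero? J)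
  ... | yes found = found
  ... | no  none  = ⊥-elim (dep λ J J⊆S J≢∅ J≡𝟎 → none (J , J⊆S , J≢∅ , J≡𝟎))

  dependent-extension⇒sumsToZero : ∀ {I e} → IndepF2 v I → ¬ IndepF2 v (I ∪ ⁅ e ⁆) →
                                   ∃ λ J → J ⊆ I ∪ ⁅ e ⁆ × e ∈ J × SumsToZero J
  dependent-extension⇒sumsToZero {I} {e} indI dep with dependent⇒sumsToZero dep
  ... | J , J⊆I∪e , J≢∅ , J≡𝟎 with e ∈? J
  ...   | yes e∈J = J , J⊆I∪e , e∈J , J≡𝟎
  ...   | no  e∉J = contradiction J≡𝟎 (indI J J⊆I J≢∅)
    where
    J⊆I : J ⊆ I
    J⊆I {x} x∈J = Sum.[ id , (λ x∈⁅e⁆ → contradiction (subst (_∈ J) (x∈⁅y⁆⇒x≡y e x∈⁅e⁆) x∈J) e∉J) ]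
                    (x∈p∪q⁻ I ⁅ e ⁆ (J⊆I∪e x∈J))

  ∈-cyc⇒sumsToZero : ∀ {Y e} → e ∈ cyc M Y → ∃ λ J → J ⊆ Y × e ∈ J × SumsToZero J
  ∈-cyc⇒sumsToZero {Y} {e} e∈cycY with ∈-cyc⁻ M e∈cycY | proj₁ (rep (Y - e))
  ... | e∈Y , ρY-e≡ρY | I , I⊆Y-e , indI , ∣I∣≡ρY-e =
    let J , J⊆S , e∈J , J≡𝟎 = dependent-extension⇒sumsToZero indI ¬indS in J , ⊆-trans J⊆S S⊆Y , e∈J , J≡𝟎
    where
    S = I ∪ ⁅ e ⁆
    S⊆Y : S ⊆ Y
    S⊆Y = ∪-least (⊆-trans I⊆Y-e (p─q⊆p Y ⁅ e ⁆)) (⁅x⁆⊆p e∈Y)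
    ¬indS : ¬ IndepF2 v S
    ¬indS indS = <⇒≱ (begin-strict
      ρ Y       ≡⟨ trans ∣I∣≡ρY-e ρY-e≡ρY ⟨
      ∣ I ∣     <⟨ p⊂q⇒∣p∣<∣q∣ (p⊆p∪q ⁅ e ⁆ , e , q⊆p∪q I ⁅ e ⁆ (x∈⁅x⁆ e) , x∉p-x Y ∘ I⊆Y-e) ⟩
      ∣ S ∣     ∎) (indep⇒∣I∣≤ρ S⊆Y indS)
      where open ≤-Reasoning

  IsCircuit : Pred (Subset n) 0ℓ
  IsCircuit C = Nonempty C × SumsToZero C × (∀ {J} → J ⊆ C → Nonempty J → SumsToZero J → J ≡ C)

  circuit-cyclic : ∀ {C} → IsCircuit C → cyc M C ≡ C
  circuit-cyclic {C} (C≢∅ , C≡𝟎 , minimal) = ⊆-antisym (cyc-⊆ M C) (λ x∈C → ∈-cyc⁺ M x∈C (ρC-x≡ρC x∈C))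
    where
    ρC-x≡ρC : ∀ {x} → x ∈ C → ρ (C - x) ≡ ρ C
    ρC-x≡ρC {x} x∈C = ≤-antisym (monotone (p─q⊆p C ⁅ x ⁆)) (begin
      ρ C         ≤⟨ s≤s⁻¹ (≤-trans (sumsToZero⇒ρ<∣∣ C≢∅ C≡𝟎) (p-x⊆q⇒∣p∣≤1+∣q∣ {x = x} {C} ⊆-refl)) ⟩
      ∣ C - x ∣   ≤⟨ indep⇒∣I∣≤ρ ⊆-refl indC-x ⟩
      ρ (C - x)   ∎)
      where
      open ≤-Reasoning
      indC-x : IndepF2 v (C - x)
      indC-x J J⊆C-x J≢∅ J≡𝟎 =
        x∉p-x C (J⊆C-x (subst (x ∈_) (sym (minimal (⊆-trans J⊆C-x (p─q⊆p C ⁅ x ⁆)) J≢∅ J≡𝟎)) x∈C))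

  ZeroSumThrough : Subset n → Fin n → Pred (Subset n) 0ℓ
  ZeroSumThrough X e J = J ⊆ X × e ∈ J × SumsToZero J

  zeroSumThrough? : ∀ X e → Decidable (ZeroSumThrough X e)
  zeroSumThrough? X e J = J ⊆? X ×-dec e ∈? J ×-dec sumsToZero? J

  smallest⇒circuit : ∀ {X e C} → Smallest (ZeroSumThrough X e) C → IsCircuit C
  smallest⇒circuit {X} {e} {C} ((C⊆X , e∈C , C≡𝟎) , least) = (e , e∈C) , C≡𝟎 , minimal
    where
    minimal : ∀ {J} → J ⊆ C → Nonempty J → SumsToZero J → J ≡ C
    minimal {J} J⊆C J≢∅ J≡𝟎 with e ∈? J
    ... | yes e∈J = p⊆q⇒∣q∣≤∣p∣⇒p≡q J⊆C (least J (⊆-trans J⊆C C⊆X , e∈J , J≡𝟎))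
    ... | no  e∉J = contradiction
      (least (C Δ J) (Δ-least C⊆X (⊆-trans J⊆C C⊆X) , ∈Δ⁺ˡ C J e∈C e∉J , sumsToZero-Δ C≡𝟎 J≡𝟎))
      (<⇒≱ (p⊂q⇒∣p∣<∣q∣ (Δ⊂ J⊆C J≢∅)))

  module _ (simple : IsSimple M) where

    indep-⁅⁆ : ∀ e → IndepF2 v ⁅ e ⁆
    indep-⁅⁆ e = ∣S∣≤ρ⇒indep (≤-reflexive (trans (∣⁅x⁆∣≡1 e) (sym (proj₁ simple e))))

    indep-pair : ∀ {e f} → e ≢ f → IndepF2 v (⁅ e ⁆ ∪ ⁅ f ⁆)
    indep-pair {e} {f} e≢f = ∣S∣≤ρ⇒indep (begin
      ∣ ⁅ e ⁆ ∪ ⁅ f ⁆ ∣         ≤⟨ ∣p∪q∣≤∣p∣+∣q∣ ⁅ e ⁆ ⁅ f ⁆ ⟩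
      ∣ ⁅ e ⁆ ∣ + ∣ ⁅ f ⁆ ∣     ≡⟨ cong₂ _+_ (∣⁅x⁆∣≡1 e) (∣⁅x⁆∣≡1 f) ⟩
      2                         ≡⟨ proj₂ simple e f e≢f ⟨
      ρ (⁅ e ⁆ ∪ ⁅ f ⁆)         ∎)
      where open ≤-Reasoning

    3≤∣sumsToZero∣ : ∀ {J} → Nonempty J → SumsToZero J → 3 ≤ ∣ J ∣
    3≤∣sumsToZero∣ {J} (e , e∈J) J≡𝟎 with nonempty? (J - e)
    ... | no  J-e≡∅ = contradiction J≡𝟎 (indep-⁅⁆ e J (Empty[p-x]⇒p⊆⁅x⁆ J-e≡∅) (e , e∈J))
    ... | yes (f , f∈J-e) with nonempty? (J - e - f)
    ...   | no  J-e-f≡∅ = contradiction J≡𝟎 (indep-pair (x∈p-y⇒x≢y J f∈J-e) J J⊆f∪e (e , e∈J))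
      where
      J⊆f∪e : J ⊆ ⁅ f ⁆ ∪ ⁅ e ⁆
      J⊆f∪e = p-x⊆q⇒p⊆q∪⁅x⁆ (Empty[p-x]⇒p⊆⁅x⁆ J-e-f≡∅)
    ...   | yes (g , g∈J-e-f) = grow e∈J (grow f∈J-e (grow g∈J-e-f z≤n))
      where
      grow : ∀ {k p} {x : Fin n} → x ∈ p → k ≤ ∣ p - x ∣ → suc k ≤ ∣ p ∣
      grow x∈p k≤∣p-x∣ = ≤-trans (s≤s k≤∣p-x∣) (x∈p⇒∣p-x∣<∣p∣ x∈p)

    ∅-isBottom : IsBottom M ⊥
    ∅-isBottom = (⊆-antisym cl∅⊆∅ ⊥⊆ , ⊆-antisym (cyc-⊆ M ⊥) ⊥⊆) , λ _ _ → ⊥⊆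
      where
      cl∅⊆∅ : cl M ⊥ ⊆ ⊥
      cl∅⊆∅ {x} x∈cl∅ = contradiction (begin
        1               ≡⟨ proj₁ simple x ⟨
        ρ ⁅ x ⁆         ≤⟨ monotone (q⊆p∪q ⊥ ⁅ x ⁆) ⟩
        ρ (⊥ ∪ ⁅ x ⁆)   ≡⟨ ∈-cl⁻ M x∈cl∅ ⟩
        ρ ⊥             ≤⟨ bounded ⊥ ⟩
        ∣ ⊥ {n} ∣        ≡⟨ ∣⊥∣≡0 n ⟩
        0               ∎) λ ()
        where open ≤-Reasoning

    flat-circuit⇒atom : ∀ {C} → IsCircuit C → cl M C ≡ C → IsAtom M C
    flat-circuit⇒atom {C} circuitC@((x , x∈C) , _ , minimal) flatC =
      (flatC , circuit-cyclic circuitC) , ⊥ , ∅-isBottom , (⊥⊆ , x , x∈C , ∉⊥) , covers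
      where
      covers : ∀ W → IsCyclicFlat M W → ⊥ ⊆ W → W ⊆ C → W ≡ ⊥ ⊎ W ≡ C
      covers W (_ , cyclicW) _ W⊆C with nonempty? W
      ... | no  W≡∅       = inj₁ (Empty-unique W≡∅)
      ... | yes (y , y∈W) =
        let J , J⊆W , y∈J , J≡𝟎 = ∈-cyc⇒sumsToZero (subst (y ∈_) (sym cyclicW) y∈W)
        in inj₂ (⊆-antisym W⊆C (subst (_⊆ W) (minimal (⊆-trans J⊆W W⊆C) (y , y∈J) J≡𝟎) J⊆W))

    smallest⇒no-exchange : ∀ {X e C D f} → Smallest (ZeroSumThrough X e) C →
                           D ⊆ X → D ⊆ C ∪ ⁅ f ⁆ → f ∉ C → f ∈ D → ¬ SumsToZero D
    smallest⇒no-exchange {X} {e} {C} {D} {f} ((C⊆X , e∈C , C≡𝟎) , least) D⊆X D⊆C∪f f∉C f∈D D≡𝟎 =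
      Sum.[ <⇒≱ (3≤∣sumsToZero∣ (f , f∈D) D≡𝟎)
          , <⇒≱ (3≤∣sumsToZero∣ (f , ∈Δ⁺ʳ C D f∉C f∈D) (sumsToZero-Δ C≡𝟎 D≡𝟎)) ]
        (exchange-bound (∣p∣+∣q∣≡∣pΔq∣+2∣p∩q∣ C D) (p-x⊆q⇒∣p∣≤1+∣q∣ {x = f} {D} D-f⊆C∩D) C-smaller)
      where
      D-f⊆C∩D : D - f ⊆ C ∩ D
      D-f⊆C∩D y∈D-f = x∈p∩q⁺ (Sum.[ id , ⊥-elim ∘ x∈p-y⇒x≢y D y∈D-f ∘ x∈⁅y⁆⇒x≡y f ]
                                 (x∈p∪q⁻ C ⁅ f ⁆ (D⊆C∪f y∈D)) , y∈D)
        where y∈D = p─q⊆p D ⁅ f ⁆ y∈D-f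
      C-smaller : ∣ C ∣ ≤ ∣ D ∣ ⊎ ∣ C ∣ ≤ ∣ C Δ D ∣
      C-smaller with e ∈? D
      ... | yes e∈D = inj₁ (least D (D⊆X , e∈D , D≡𝟎))
      ... | no  e∉D = inj₂ (least (C Δ D) (Δ-least C⊆X D⊆X , ∈Δ⁺ˡ C D e∈C e∉D , sumsToZero-Δ C≡𝟎 D≡𝟎))

    smallest⇒flat : ∀ {X e C} → cl M X ≡ X → Smallest (ZeroSumThrough X e) C → cl M C ≡ C
    smallest⇒flat {X} {e} {C} flatX smallestC = ⊆-antisym cl⊆C (⊆-cl M C)
      where
      C⊆X : C ⊆ X
      C⊆X = proj₁ (proj₁ smallestC)
      cl⊆C : cl M C ⊆ C
      cl⊆C {f} f∈clC with f ∈? C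
      ... | yes f∈C = f∈C
      ... | no  f∉C =
        let D , D⊆C∪f , f∈D , D≡𝟎 = ∈-cyc⇒sumsToZero f∈cyc[C∪f]
        in ⊥-elim (smallest⇒no-exchange smallestC (⊆-trans D⊆C∪f C∪f⊆X) D⊆C∪f f∉C f∈D D≡𝟎)
        where
        C∪f⊆X : C ∪ ⁅ f ⁆ ⊆ X
        C∪f⊆X = ∪-least C⊆X (⁅x⁆⊆p (cl-⊆-flat M flatX C⊆X f∈clC))
        C⊆C∪f-f : C ⊆ C ∪ ⁅ f ⁆ - f
        C⊆C∪f-f x∈C = x∈p∧x≢y⇒x∈p-y (p⊆p∪q ⁅ f ⁆ x∈C) (λ { refl → f∉C x∈C })
        f∈cyc[C∪f] : f ∈ cyc M (C ∪ ⁅ f ⁆)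
        f∈cyc[C∪f] = ∈-cyc⁺ M (q⊆p∪q C ⁅ f ⁆ (x∈⁅x⁆ f))
          (≤-antisym (monotone (p─q⊆p (C ∪ ⁅ f ⁆) ⁅ f ⁆))
                     (≤-trans (≤-reflexive (∈-cl⁻ M f∈clC)) (monotone C⊆C∪f-f)))

    atom-through : ∀ {X y} → IsCyclicFlat M X → y ∈ X → ∃ λ C → IsAtom M C × C ⊆ X × y ∈ C
    atom-through {X} {y} (flatX , cyclicX) y∈X =
      let C , smallestC = smallest (zeroSumThrough? X y) (∈-cyc⇒sumsToZero (subst (y ∈_) (sym cyclicX) y∈X))
          C⊆X , y∈C , _ = proj₁ smallestC
      in C , flat-circuit⇒atom (smallest⇒circuit smallestC) (smallest⇒flat flatX smallestC) , C⊆X , y∈C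

theorem7p8 : ∀ {n : ℕ} (M : Matroid n) → IsBinary M → IsSimple M →
    (∀ e → ¬ IsIsthmus M e) →
    ∀ (X : Subset n) → IsCyclicFlat M X →
    Σ (List (Subset n)) λ As → All (IsAtom M) As × X ≡ ⋁ M As
theorem7p8 M (m , v , rep) simple _ X cyclicFlatX =
  flat-join-of-cover M (IsAtom M) (proj₁ cyclicFlatX) (Binary.atom-through M v rep simple cyclicFlatX)
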